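{- Let $G=\mathbb{Z}\oplus\mathbb{Z}/\mu_1\mathbb{Z}\oplus\dots\oplus\mathbb{Z}/\mu_r\mathbb{Z}$ with positive integers $\mu_r\mid\dots\mid\mu_1$, and let $\omega_i=(w_i,\eta_i)\in G$, $i=0,\dots,n$, with $w_i\in\mathbb{Z}_{\ge 1}$ and $\eta_i=(\eta_{i1},\dots,\eta_{ir})$, $\eta_{ij}\in\mathbb{Z}/\mu_j\mathbb{Z}$, such that $\omega_0,\dots,\omega_n$ generate $G$. Let $\eta'_{ij}\in\{0,\dots,\mu_j-1\}$ represent $\eta_{ij}$, and set $L=\mathrm{lcm}(w_0,\dots,w_n)$, $L_{ij}=\frac{L}{w_i}\eta'_{ij}$, $M_j=\frac{\mu_j}{\gcd(\mu_j,L_{0j},\dots,L_{nj})}$ and $M=\mathrm{lcm}(M_1,\dots,M_r)$. Then $$\bigcap_{i=0}^n\langle\omega_i\rangle=\langle (LM,0)\rangle.$$ -}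

module Defs where

open import Data.Nat as ℕ using (ℕ; zero; suc)
open import Data.Nat.DivMod using (_/_)
open import Data.Nat.GCD using (gcd)
open import Data.Nat.LCM using (lcm)
open import Data.Integer as ℤ using (ℤ; +_)
open import Data.Integer.Divisibility as ℤD using ()
open import Data.Fin using (Fin; toℕ)
open import Data.Product using (_×_; _,_; proj₁; proj₂)
open import Function using (_∘_)
open import Relation.Binary.PropositionalEquality using (_≡_)

-- Natural-number division, a / b, with the (irrelevant here) convention a / 0 = 0.
-- It is only ever applied with a positive divisor.
_div_ : ℕ → ℕ → ℕ
a div zero = zero
a div (suc b) = a / suc b

lcmF : ∀ {m} → (Fin m → ℕ) → ℕ
lcmF {zero} f = 1
lcmF {suc m} f = lcm (f Fin.zero) (lcmF (f ∘ Fin.suc))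
  where import Data.Fin as Fin

gcdF : ∀ {m} → (Fin m → ℕ) → ℕ
gcdF {zero} f = 0
gcdF {suc m} f = gcd (f Fin.zero) (gcdF (f ∘ Fin.suc))
  where import Data.Fin as Fin

-- The group G = ℤ ⊕ ℤ/μ₁ ⊕ … ⊕ ℤ/μᵣ, elements represented by integer tuples,
-- with equality being equality in ℤ on the first coordinate and congruence
-- mod μ_j on coordinate j.
module Group {r : ℕ} (μ : Fin r → ℕ) where

  G : Set
  G = ℤ × (Fin r → ℤ)

  _≈G_ : G → G → Set
  (a , x) ≈G (b , y) = (a ≡ b) × (∀ j → (+ μ j) ℤD.∣ (x j ℤ.- y j))

  _+G_ : G → G → G
  (a , x) +G (b , y) = (a ℤ.+ b , λ j → x j ℤ.+ y j)

  0G : G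
  0G = (+ 0 , λ _ → + 0)

  _·G_ : ℤ → G → G
  k ·G (a , x) = (k ℤ.* a , λ j → k ℤ.* x j)

  lincomb : ∀ {m} → (Fin m → ℤ) → (Fin m → G) → G
  lincomb {zero} c g = 0G
  lincomb {suc m} c g = (c Fin.zero ·G g Fin.zero) +G lincomb (c ∘ Fin.suc) (g ∘ Fin.suc)
    where import Data.Fin as Fin

  ω : ∀ {m} → (Fin m → ℕ) → (Fin m → (j : Fin r) → Fin (μ j)) → Fin m → G
  ω w η i = (+ w i , λ j → + toℕ (η i j))

module Numbers {r n : ℕ} (μ : Fin r → ℕ) (w : Fin (suc n) → ℕ)
               (η : Fin (suc n) → (j : Fin r) → Fin (μ j)) where

  L : ℕ
  L = lcmF w

  Lij : Fin (suc n) → Fin r → ℕ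
  Lij i j = (L div w i) ℕ.* toℕ (η i j)

  Mj : Fin r → ℕ
  Mj j = μ j div gcd (μ j) (gcdF (λ i → Lij i j))

  M : ℕ
  M = lcmF Mj

{-# OPTIONS --safe #-}
-- For g = (a, x) and a fixed coordinate j, the map h = (b, y) ↦ x_j b − a y_j
-- is a homomorphism G → ℤ/μ_j which vanishes on every h of which g is a
-- multiple. If g lies in every ⟨ω_i⟩ it therefore vanishes on
-- ⟨ω_0, …, ω_n⟩ = G, in particular on (1, 0), where its value is x_j: the torsion
-- part of g is zero. For such g, g = k_i ω_i says a = k_i w_i and μ_j ∣ k_i η_ij.
-- The first condition for all i means a = uL with k_i = u L / w_i; the second
-- then reads μ_j ∣ u L_ij, which for all i holds iff M_j ∣ u, and for all i, j
-- iff M ∣ u.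
module Submission where

open import Defs
open import Data.Nat using (ℕ; suc; _≤_; _*_)
open import Data.Nat.Divisibility using (_∣_)
open import Data.Integer using (ℤ; +_)
open import Data.Fin using (Fin)
open import Data.Product using (Σ; _×_; _,_)

open import Data.Nat as ℕ using (zero; NonZero)
import Data.Nat.Properties as ℕₚ
import Data.Nat.Divisibility as ℕ∣
open import Data.Nat.DivMod using (_/_; m/n*n≡m)
open import Data.Nat.GCD
  using (gcd; gcd[m,n]∣m; gcd[m,n]∣n; gcd-greatest; gcd[m,n]≢0; c*gcd[m,n]≡gcd[cm,cn])
open import Data.Nat.LCM using (m∣lcm[m,n]; n∣lcm[m,n]; lcm-least)
import Data.Nat.Tactic.RingSolver as ℕ-ring
import Data.Integer as ℤ
import Data.Integer.Properties as ℤₚ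
open import Data.Integer.Divisibility.Signed as ℤ∣ using (divides) renaming (_∣_ to _∣ℤ_)
open import Data.Integer.Tactic.RingSolver using (solve-∀)
open import Data.Fin as Fin using (toℕ)
open import Data.Product using (proj₁; proj₂)
open import Data.Sum using (inj₁)
open import Function using (_∘_)
open import Relation.Binary.PropositionalEquality

∣lcmF : ∀ {m} (f : Fin m → ℕ) i → f i ∣ lcmF f
∣lcmF f Fin.zero    = m∣lcm[m,n] _ _
∣lcmF f (Fin.suc i) =
  ℕ∣.∣-trans (∣lcmF (f ∘ Fin.suc) i) (n∣lcm[m,n] (f Fin.zero) (lcmF (f ∘ Fin.suc)))

lcmF-least : ∀ {m} (f : Fin m → ℕ) {c} → (∀ i → f i ∣ c) → lcmF f ∣ c
lcmF-least {zero}  f {c} _   = ℕ∣.1∣ c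
lcmF-least {suc m} f     f∣c = lcm-least (f∣c Fin.zero) (lcmF-least (f ∘ Fin.suc) (f∣c ∘ Fin.suc))

gcdF∣ : ∀ {m} (f : Fin m → ℕ) i → gcdF f ∣ f i
gcdF∣ f Fin.zero    = gcd[m,n]∣m _ _
gcdF∣ f (Fin.suc i) =
  ℕ∣.∣-trans (gcd[m,n]∣n (f Fin.zero) (gcdF (f ∘ Fin.suc))) (gcdF∣ (f ∘ Fin.suc) i)

gcdF-greatest : ∀ {m} (f : Fin m → ℕ) {c} → (∀ i → c ∣ f i) → c ∣ gcdF f
gcdF-greatest {zero}  f {c} _   = c ℕ∣.∣0
gcdF-greatest {suc m} f     c∣f =
  gcd-greatest (c∣f Fin.zero) (gcdF-greatest (f ∘ Fin.suc) (c∣f ∘ Fin.suc))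

c*gcdF[f]≡gcdF[c*f] : ∀ {m} c (f : Fin m → ℕ) → c * gcdF f ≡ gcdF (λ i → c * f i)
c*gcdF[f]≡gcdF[c*f] {zero}  c f = ℕₚ.*-zeroʳ c
c*gcdF[f]≡gcdF[c*f] {suc m} c f = trans (c*gcd[m,n]≡gcd[cm,cn] c _ _)
  (cong (gcd (c * f Fin.zero)) (c*gcdF[f]≡gcdF[c*f] c (f ∘ Fin.suc)))

div≡/ : ∀ m n .{{_ : NonZero n}} → m div n ≡ m / n
div≡/ m (suc n) = refl

gcd≢0ˡ : ∀ m n .{{_ : NonZero m}} → NonZero (gcd m n)
gcd≢0ˡ m n = ℕ.≢-nonZero (gcd[m,n]≢0 m n (inj₁ (ℕ.≢-nonZero⁻¹ m)))

-- μ div gcd μ (gcdF ℓ) is the order of the subgroup of ℤ/μ generated by the ℓ i.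
module _ (μ : ℕ) .{{_ : NonZero μ}} {m} (ℓ : Fin m → ℕ) where

  private instance
    gcd≢0 : NonZero (gcd μ (gcdF ℓ))
    gcd≢0 = gcd≢0ˡ μ (gcdF ℓ)

  μ∣u*ℓ⇒μ/gcd∣u : ∀ {u} → (∀ i → μ ∣ u * ℓ i) → μ div gcd μ (gcdF ℓ) ∣ u
  μ∣u*ℓ⇒μ/gcd∣u {u} μ∣u*ℓ = subst (_∣ u) (sym (div≡/ μ (gcd μ (gcdF ℓ))))
    (ℕ∣.m∣n*o⇒m/n∣o (gcd[m,n]∣m μ (gcdF ℓ)) μ∣u*gcd)
    where
    open ℕ∣.∣-Reasoning
    μ∣u*gcd : μ ∣ u * gcd μ (gcdF ℓ)
    μ∣u*gcd = begin
      μ                                   ∣⟨ gcd-greatest (ℕ∣.n∣m*n u) (gcdF-greatest _ μ∣u*ℓ) ⟩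
      gcd (u * μ) (gcdF (λ i → u * ℓ i))  ≡⟨ cong (gcd (u * μ)) (c*gcdF[f]≡gcdF[c*f] u ℓ) ⟨
      gcd (u * μ) (u * gcdF ℓ)            ≡⟨ c*gcd[m,n]≡gcd[cm,cn] u μ (gcdF ℓ) ⟨
      u * gcd μ (gcdF ℓ)                  ∎

  μ/gcd∣u⇒μ∣u*ℓ : ∀ {u} → μ div gcd μ (gcdF ℓ) ∣ u → ∀ i → μ ∣ u * ℓ i
  μ/gcd∣u⇒μ∣u*ℓ {u} μ/gcd∣u i = begin
    μ                   ∣⟨ ℕ∣.m/n∣o⇒m∣o*n (gcd[m,n]∣m μ (gcdF ℓ)) μ/gcd∣u′ ⟩
    u * gcd μ (gcdF ℓ)  ∣⟨ ℕ∣.*-monoʳ-∣ u (ℕ∣.∣-trans (gcd[m,n]∣n μ (gcdF ℓ)) (gcdF∣ ℓ i)) ⟩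
    u * ℓ i             ∎
    where
    open ℕ∣.∣-Reasoning
    μ/gcd∣u′ : μ / gcd μ (gcdF ℓ) ∣ u
    μ/gcd∣u′ = subst (_∣ u) (div≡/ μ (gcd μ (gcdF ℓ))) μ/gcd∣u

∣m∣m-n⇒∣n : ∀ {i m n} → i ∣ℤ m → i ∣ℤ m ℤ.- n → i ∣ℤ n
∣m∣m-n⇒∣n {i} {m} {n} i∣m i∣m-n = subst (i ∣ℤ_) (m-[m-n]≡n m n) (ℤ∣.∣m∣n⇒∣m-n i∣m i∣m-n)
  where
  m-[m-n]≡n : ∀ m n → m ℤ.- (m ℤ.- n) ≡ n
  m-[m-n]≡n = solve-∀

m-n*0≡m : ∀ m n → m ℤ.- n ℤ.* + 0 ≡ m
m-n*0≡m = solve-∀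

t*+[m*n]≡t*+m*+n : ∀ t m n → t ℤ.* + (m * n) ≡ t ℤ.* + m ℤ.* + n
t*+[m*n]≡t*+m*+n t m n = trans (cong (t ℤ.*_) (ℤₚ.pos-* m n)) (sym (ℤₚ.*-assoc t (+ m) (+ n)))

module CyclicSubgroups {r} (μ : Fin r → ℕ) where
  open Group μ

  _∈⟨_⟩ : G → G → Set
  g ∈⟨ h ⟩ = Σ ℤ λ k → g ≈G (k ·G h)

  TorsionVanishes : G → Set
  TorsionVanishes (_ , x) = ∀ j → + μ j ∣ℤ x j

  cross : Fin r → G → G → ℤ
  cross j (a , x) (b , y) = x j ℤ.* b ℤ.- a ℤ.* y j

  cross-+G : ∀ j g h h′ → cross j g (h +G h′) ≡ cross j g h ℤ.+ cross j g h′
  cross-+G j (a , x) (b , y) (b′ , y′) = ring (x j) a b b′ (y j) (y′ j)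
    where
    ring : ∀ x a b b′ y y′ → x ℤ.* (b ℤ.+ b′) ℤ.- a ℤ.* (y ℤ.+ y′)
                           ≡ (x ℤ.* b ℤ.- a ℤ.* y) ℤ.+ (x ℤ.* b′ ℤ.- a ℤ.* y′)
    ring = solve-∀

  cross-·G : ∀ j g k h → cross j g (k ·G h) ≡ k ℤ.* cross j g h
  cross-·G j (a , x) k (b , y) = ring (x j) a k b (y j)
    where
    ring : ∀ x a k b y → x ℤ.* (k ℤ.* b) ℤ.- a ℤ.* (k ℤ.* y) ≡ k ℤ.* (x ℤ.* b ℤ.- a ℤ.* y)
    ring = solve-∀

  cross-0G : ∀ j g → cross j g 0G ≡ + 0
  cross-0G j (a , x) = ring (x j) a
    where
    ring : ∀ x a → x ℤ.* + 0 ℤ.- a ℤ.* + 0 ≡ + 0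
    ring = solve-∀

  cross-unit : ∀ j g → cross j g (+ 1 , λ _ → + 0) ≡ proj₂ g j
  cross-unit j (a , x) = ring (x j) a
    where
    ring : ∀ x a → x ℤ.* + 1 ℤ.- a ℤ.* + 0 ≡ x
    ring = solve-∀

  cross-∈⟨⟩ : ∀ {g h} → g ∈⟨ h ⟩ → ∀ j → + μ j ∣ℤ cross j g h
  cross-∈⟨⟩ {a , x} {b , y} (k , refl , μ∣x-ky) j =
    subst (+ μ j ∣ℤ_) (ring (x j) k b (y j)) (ℤ∣.∣n⇒∣m*n b (ℤ∣.∣ᵤ⇒∣ (μ∣x-ky j)))
    where
    ring : ∀ x k b y → b ℤ.* (x ℤ.- k ℤ.* y) ≡ x ℤ.* b ℤ.- k ℤ.* b ℤ.* y
    ring = solve-∀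

  cross-lincomb : ∀ {m} j g (c : Fin m → ℤ) (h : Fin m → G) →
                  (∀ i → + μ j ∣ℤ cross j g (h i)) → + μ j ∣ℤ cross j g (lincomb c h)
  cross-lincomb {zero}  j g c h _  = subst (+ μ j ∣ℤ_) (sym (cross-0G j g)) (divides (+ 0) refl)
  cross-lincomb {suc m} j g c h μ∣ = subst (+ μ j ∣ℤ_) (sym cross-cons)
    (ℤ∣.∣m∣n⇒∣m+n (ℤ∣.∣n⇒∣m*n (c Fin.zero) (μ∣ Fin.zero))
                  (cross-lincomb j g c′ h′ (μ∣ ∘ Fin.suc)))
    where
    c′ : Fin m → ℤ
    c′ = c ∘ Fin.suc
    h′ : Fin m → G
    h′ = h ∘ Fin.suc
    cross-cons : cross j g (lincomb c h)
               ≡ c Fin.zero ℤ.* cross j g (h Fin.zero) ℤ.+ cross j g (lincomb c′ h′)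
    cross-cons = trans (cross-+G j g (c Fin.zero ·G h Fin.zero) (lincomb c′ h′))
      (cong (ℤ._+ cross j g (lincomb c′ h′)) (cross-·G j g (c Fin.zero) (h Fin.zero)))

  cross-≈ : ∀ {h h′} j g → h ≈G h′ → + μ j ∣ℤ cross j g h′ → + μ j ∣ℤ cross j g h
  cross-≈ {b , y} {.b , y′} j (a , x) (refl , μ∣y-y′) μ∣cross =
    subst (+ μ j ∣ℤ_) (ring (x j) a b (y j) (y′ j))
      (ℤ∣.∣m∣n⇒∣m-n μ∣cross (ℤ∣.∣n⇒∣m*n a (ℤ∣.∣ᵤ⇒∣ (μ∣y-y′ j))))
    where
    ring : ∀ x a b y y′ → x ℤ.* b ℤ.- a ℤ.* y′ ℤ.- a ℤ.* (y ℤ.- y′) ≡ x ℤ.* b ℤ.- a ℤ.* y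
    ring = solve-∀

  torsion-vanishes : ∀ {m g} (c : Fin m → ℤ) (h : Fin m → G) →
                     (+ 1 , λ _ → + 0) ≈G lincomb c h → (∀ i → g ∈⟨ h i ⟩) → TorsionVanishes g
  torsion-vanishes {g = g} c h 1≈Σch g∈⟨h⟩ j = subst (+ μ j ∣ℤ_) (cross-unit j g)
    (cross-≈ {+ 1 , λ _ → + 0} {lincomb c h} j g 1≈Σch
      (cross-lincomb j g c h (λ i → cross-∈⟨⟩ {g} {h i} (g∈⟨h⟩ i) j)))

  ∈⟨⟩⇒ : ∀ {a x b y} → TorsionVanishes (a , x) → (a , x) ∈⟨ (b , y) ⟩ →
         Σ ℤ λ k → a ≡ k ℤ.* b × (∀ j → + μ j ∣ℤ k ℤ.* y j)
  ∈⟨⟩⇒ μ∣x (k , a≡kb , μ∣x-ky) = k , a≡kb , λ j → ∣m∣m-n⇒∣n (μ∣x j) (ℤ∣.∣ᵤ⇒∣ (μ∣x-ky j))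

  ⇒∈⟨⟩ : ∀ {a x b y} k → TorsionVanishes (a , x) → a ≡ k ℤ.* b →
         (∀ j → + μ j ∣ℤ k ℤ.* y j) → (a , x) ∈⟨ (b , y) ⟩
  ⇒∈⟨⟩ k μ∣x a≡kb μ∣ky = k , a≡kb , λ j → ℤ∣.∣⇒∣ᵤ (ℤ∣.∣m∣n⇒∣m-n (μ∣x j) (μ∣ky j))

  ∈⟨free⟩⇒ : ∀ {c a x} → (a , x) ∈⟨ (+ c , λ _ → + 0) ⟩ → + c ∣ℤ a × TorsionVanishes (a , x)
  ∈⟨free⟩⇒ {x = x} (t , a≡tc , μ∣x-t0) =
    divides t a≡tc , λ j → subst (+ μ j ∣ℤ_) (m-n*0≡m (x j) t) (ℤ∣.∣ᵤ⇒∣ (μ∣x-t0 j))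

  ⇒∈⟨free⟩ : ∀ {c a x} → + c ∣ℤ a → TorsionVanishes (a , x) → (a , x) ∈⟨ (+ c , λ _ → + 0) ⟩
  ⇒∈⟨free⟩ {x = x} (divides t a≡tc) μ∣x =
    t , a≡tc , λ j → ℤ∣.∣⇒∣ᵤ (subst (+ μ j ∣ℤ_) (sym (m-n*0≡m (x j) t)) (μ∣x j))

module Intersection {r n : ℕ} (μ : Fin r → ℕ) (w : Fin (suc n) → ℕ)
                    (η : Fin (suc n) → (j : Fin r) → Fin (μ j))
                    (μ≥1 : ∀ j → 1 ≤ μ j) (w≥1 : ∀ i → 1 ≤ w i) where
  open Numbers μ w η
  open Group μ using (ω)
  open CyclicSubgroups μ

  private instance
    μ≢0 : ∀ {j} → NonZero (μ j)
    μ≢0 {j} = ℕ.>-nonZero (μ≥1 j)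
    w≢0 : ∀ {i} → NonZero (w i)
    w≢0 {i} = ℕ.>-nonZero (w≥1 i)

  μ∣u*Lij⇒M∣u : ∀ {u} → (∀ j i → μ j ∣ u * Lij i j) → M ∣ u
  μ∣u*Lij⇒M∣u μ∣u*Lij = lcmF-least Mj (λ j → μ∣u*ℓ⇒μ/gcd∣u (μ j) (λ i → Lij i j) (μ∣u*Lij j))

  M∣u⇒μ∣u*Lij : ∀ {u} → M ∣ u → ∀ j i → μ j ∣ u * Lij i j
  M∣u⇒μ∣u*Lij M∣u j = μ/gcd∣u⇒μ∣u*ℓ (μ j) (λ i → Lij i j) (ℕ∣.∣-trans (∣lcmF Mj j) M∣u)

  L/w*w≡L : ∀ i → L div w i * w i ≡ L
  L/w*w≡L i = trans (cong (_* w i) (div≡/ L (w i))) (m/n*n≡m (∣lcmF w i))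

  common-multiple⇒LM∣ : ∀ {A} → (∀ i → Σ ℕ λ κ → A ≡ κ * w i × (∀ j → μ j ∣ κ * toℕ (η i j))) →
                        L * M ∣ A
  common-multiple⇒LM∣ {A} multiple =
    subst (L * M ∣_) (sym (ℕ∣.m∣n⇒n≡m*quotient L∣A)) (ℕ∣.*-monoʳ-∣ L (μ∣u*Lij⇒M∣u μ∣u*Lij))
    where
    κ : Fin (suc n) → ℕ
    κ i = proj₁ (multiple i)

    A≡κw : ∀ i → A ≡ κ i * w i
    A≡κw i = proj₁ (proj₂ (multiple i))

    μ∣κη : ∀ i j → μ j ∣ κ i * toℕ (η i j)
    μ∣κη i = proj₂ (proj₂ (multiple i))

    L∣A : L ∣ A
    L∣A = lcmF-least w (λ i → ℕ∣.divides (κ i) (A≡κw i))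

    u : ℕ
    u = ℕ∣._∣_.quotient L∣A

    κ≡u*L/w : ∀ i → κ i ≡ u * (L div w i)
    κ≡u*L/w i = ℕₚ.*-cancelʳ-≡ _ _ (w i) (begin
      κ i * w i              ≡⟨ A≡κw i ⟨
      A                      ≡⟨ ℕ∣.m∣n⇒n≡quotient*m L∣A ⟩
      u * L                  ≡⟨ cong (u *_) (L/w*w≡L i) ⟨
      u * (L div w i * w i)  ≡⟨ ℕₚ.*-assoc u (L div w i) (w i) ⟨
      u * (L div w i) * w i  ∎)
      where open ≡-Reasoning

    μ∣u*Lij : ∀ j i → μ j ∣ u * Lij i j
    μ∣u*Lij j i = subst (μ j ∣_)
      (trans (cong (_* toℕ (η i j)) (κ≡u*L/w i)) (ℕₚ.*-assoc u (L div w i) (toℕ (η i j))))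
      (μ∣κη i j)

  ∈⟨ω⟩⇒LM∣ : ∀ {a x} → TorsionVanishes (a , x) → (∀ i → (a , x) ∈⟨ ω w η i ⟩) → + (L * M) ∣ℤ a
  ∈⟨ω⟩⇒LM∣ {a} μ∣x a∈⟨ω⟩ = ℤ∣.∣ᵤ⇒∣ (common-multiple⇒LM∣ multiple)
    where
    multiple : ∀ i → Σ ℕ λ κ → ℤ.∣ a ∣ ≡ κ * w i × (∀ j → μ j ∣ κ * toℕ (η i j))
    multiple i with ∈⟨⟩⇒ μ∣x (a∈⟨ω⟩ i)
    ... | k , a≡kw , μ∣kη = ℤ.∣ k ∣ , trans (cong ℤ.∣_∣ a≡kw) (ℤₚ.abs-* k (+ w i)) ,
                            λ j → subst (μ j ∣_) (ℤₚ.abs-* k (+ toℕ (η i j))) (ℤ∣.∣⇒∣ᵤ (μ∣kη j))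

  LM∣⇒∈⟨ω⟩ : ∀ {a x} → TorsionVanishes (a , x) → + (L * M) ∣ℤ a → ∀ i → (a , x) ∈⟨ ω w η i ⟩
  LM∣⇒∈⟨ω⟩ {a} μ∣x (divides t a≡t*LM) i = ⇒∈⟨⟩ (t ℤ.* + κ) μ∣x a≡tκw μ∣tκη
    where
    κ : ℕ
    κ = L div w i * M

    LM≡κw : L * M ≡ κ * w i
    LM≡κw = trans (cong (_* M) (sym (L/w*w≡L i))) (ring (L div w i) (w i) M)
      where
      ring : ∀ q w M → q * w * M ≡ q * M * w
      ring = ℕ-ring.solve-∀

    a≡tκw : a ≡ t ℤ.* + κ ℤ.* + w i
    a≡tκw = trans a≡t*LM (trans (cong (λ m → t ℤ.* + m) LM≡κw) (t*+[m*n]≡t*+m*+n t κ (w i)))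

    μ∣κη : ∀ j → μ j ∣ κ * toℕ (η i j)
    μ∣κη j = subst (μ j ∣_) (ring (L div w i) M (toℕ (η i j))) (M∣u⇒μ∣u*Lij ℕ∣.∣-refl j i)
      where
      ring : ∀ q M e → M * (q * e) ≡ q * M * e
      ring = ℕ-ring.solve-∀

    μ∣tκη : ∀ j → + μ j ∣ℤ t ℤ.* + κ ℤ.* + toℕ (η i j)
    μ∣tκη j = subst (+ μ j ∣ℤ_) (t*+[m*n]≡t*+m*+n t κ (toℕ (η i j)))
      (ℤ∣.∣n⇒∣m*n t (ℤ∣.∣ᵤ⇒∣ (μ∣κη j)))

proposition3p4 : (r n : ℕ) (μ : Fin r → ℕ) (w : Fin (suc n) → ℕ)
    (η : Fin (suc n) → (j : Fin r) → Fin (μ j))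
    → (∀ j → 1 ≤ μ j)
    → (∀ (j k : Fin r) → j Data.Fin.≤ k → μ k ∣ μ j)
    → (∀ i → 1 ≤ w i)
    → (∀ (g : Group.G μ) → Σ (Fin (suc n) → ℤ) λ c → Group._≈G_ μ g (Group.lincomb μ c (Group.ω μ w η)))
    → ∀ (g : Group.G μ)
    → ((∀ i → Σ ℤ λ k → Group._≈G_ μ g (Group._·G_ μ k (Group.ω μ w η i)))
         → Σ ℤ λ t → Group._≈G_ μ g (Group._·G_ μ t (+ (Numbers.L μ w η * Numbers.M μ w η) , λ _ → + 0)))
      × ((Σ ℤ λ t → Group._≈G_ μ g (Group._·G_ μ t (+ (Numbers.L μ w η * Numbers.M μ w η) , λ _ → + 0)))
         → ∀ i → Σ ℤ λ k → Group._≈G_ μ g (Group._·G_ μ k (Group.ω μ w η i)))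
proposition3p4 r n μ w η μ≥1 _ w≥1 generate (a , x) = ⊆ , ⊇
  where
  open Numbers μ w η using (L; M)
  open Group μ using (ω)
  open CyclicSubgroups μ
  open Intersection μ w η μ≥1 w≥1

  ⊆ : (∀ i → (a , x) ∈⟨ ω w η i ⟩) → (a , x) ∈⟨ (+ (L * M) , λ _ → + 0) ⟩
  ⊆ a∈⟨ω⟩ = ⇒∈⟨free⟩ (∈⟨ω⟩⇒LM∣ μ∣x a∈⟨ω⟩) μ∣x
    where
    μ∣x : TorsionVanishes (a , x)
    μ∣x with generate (+ 1 , λ _ → + 0)
    ... | c , 1≈Σcω = torsion-vanishes c (ω w η) 1≈Σcω a∈⟨ω⟩

  ⊇ : (a , x) ∈⟨ (+ (L * M) , λ _ → + 0) ⟩ → ∀ i → (a , x) ∈⟨ ω w η i ⟩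
  ⊇ a∈⟨LM⟩ with ∈⟨free⟩⇒ {x = x} a∈⟨LM⟩
  ... | LM∣a , μ∣x = LM∣⇒∈⟨ω⟩ μ∣x LM∣a
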